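{- The base-cobase graph $G(R_{10},R_{10}^\ast)$ of the matroid $R_{10}$ is bipartite, and therefore not Hamiltonian connected.
   Context: $R_{10}$ is the matroid with ground set $\binom{[5]}{3}$ (the ten 3-element subsets of $\{1,2,3,4,5\}$) in which a collection of triples is independent iff their incidence vectors in $\mathbb{F}_2^5$ are linearly independent, i.e. no nonempty subcollection covers every element of $\{1,\dots,5\}$ an even number of times. For a matroid $M$ on $E$, a base-cobase is a base $B$ with $E\setminus B$ also a base; $G(M,M^\ast)$ has the base-cobases as vertices, two adjacent iff their symmetric difference has exactly two elements. A graph is Hamiltonian connected if any two distinct vertices are the endpoints of a Hamiltonian path. -}

module Defs where

open import Data.Bool using (Bool; true; false)
open import Data.Nat using (ℕ)
open import Data.Nat.Divisibility using (_∣_)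
open import Data.Fin using (Fin)
open import Data.Fin.Subset using (Subset; _∈_; _⊆_; _∩_; _∪_; _─_; ∁; ∣_∣; Nonempty)
open import Data.Vec using (Vec; []; _∷_; lookup; tabulate)
open import Data.List using (List; []; _∷_; _++_)
open import Data.List.Relation.Unary.All using (All)
open import Data.List.Relation.Unary.Linked using (Linked)
open import Data.List.Relation.Unary.Unique.Propositional using (Unique)
import Data.List.Membership.Propositional as L
open import Data.Product using (Σ; ∃; _×_)
open import Relation.Binary.PropositionalEquality using (_≡_; _≢_)
open import Relation.Nullary using (¬_)

-- Ground set of R10: the ten 3-element subsets of {1,..,5}, enumerated
-- (in lexicographic order) as Fin 10.  triple i is the incidence vector
-- in F2^5 (= Subset 5 = Vec Bool 5) of the i-th triple.
pattern O = false
pattern I = true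

triples : Vec (Subset 5) 10
triples =
    (I ∷ I ∷ I ∷ O ∷ O ∷ []) ∷
    (I ∷ I ∷ O ∷ I ∷ O ∷ []) ∷
    (I ∷ I ∷ O ∷ O ∷ I ∷ []) ∷
    (I ∷ O ∷ I ∷ I ∷ O ∷ []) ∷
    (I ∷ O ∷ I ∷ O ∷ I ∷ []) ∷
    (I ∷ O ∷ O ∷ I ∷ I ∷ []) ∷
    (O ∷ I ∷ I ∷ I ∷ O ∷ []) ∷
    (O ∷ I ∷ I ∷ O ∷ I ∷ []) ∷
    (O ∷ I ∷ O ∷ I ∷ I ∷ []) ∷
    (O ∷ O ∷ I ∷ I ∷ I ∷ []) ∷
    []

triple : Fin 10 → Subset 5
triple i = lookup triples i

covers : Fin 5 → Subset 10
covers j = tabulate (λ i → lookup (triple i) j)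

-- S covers every point of {1,..,5} an even number of times
-- (i.e. the F2-sum of the incidence vectors of S is zero)
EvenCover : Subset 10 → Set
EvenCover S = ∀ (j : Fin 5) → 2 ∣ ∣ S ∩ covers j ∣

Independent : Subset 10 → Set
Independent B = ∀ (S : Subset 10) → S ⊆ B → Nonempty S → ¬ EvenCover S

Base : Subset 10 → Set
Base B = Independent B × (∀ (S : Subset 10) → Independent S → B ⊆ S → S ≡ B)

BaseCobase : Subset 10 → Set
BaseCobase B = Base B × Base (∁ B)

Adjacent : Subset 10 → Subset 10 → Set
Adjacent B B' = ∣ (B ─ B') ∪ (B' ─ B) ∣ ≡ 2

Bipartite : Set
Bipartite = Σ (Subset 10 → Bool) λ c →
  ∀ u v → BaseCobase u → BaseCobase v → Adjacent u v → c u ≢ c v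

HamiltonianPath : Subset 10 → Subset 10 → List (Subset 10) → Set
HamiltonianPath u v p =
  (∃ λ mid → p ≡ u ∷ (mid ++ (v ∷ []))) ×
  All BaseCobase p ×
  Linked Adjacent p ×
  Unique p ×
  (∀ w → BaseCobase w → w L.∈ p)

HamiltonianConnected : Set
HamiltonianConnected = ∀ u v → BaseCobase u → BaseCobase v → u ≢ v →
  ∃ λ p → HamiltonianPath u v p

module Submission where

-- The base-cobases of R10 are found by exhaustive search over the 2^10 subsets: independence is
-- decided by looking for an even cover among the subsets, and maximality only has to be tested
-- against one-element extensions. There are 72 of them, and colouring a base-cobase B by the sign
-- of det A_B · det A_(E∖B) · sgn(B, E∖B), where A is the integer incidence matrix of the triples,
-- is checked to be a proper 2-colouring of G(R10, R10*). A Hamiltonian path visits all 72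
-- vertices, so it has an odd number of edges and joins vertices of different colours: two
-- base-cobases of the same colour are not its endpoints.

open import Defs
open import Data.Product using (_×_)
open import Relation.Nullary using (¬_)

open import Data.Bool using (Bool; true; false; if_then_else_; _xor_)
open import Data.Bool.Properties using (¬-not) renaming (_≟_ to _≟ᵇ_)
open import Data.Empty using (⊥-elim)
open import Data.Fin using (Fin; toℕ)
open import Data.Fin.Properties using (all?)
open import Data.Fin.Subset using (Subset; inside; outside; ∣_∣; _∩_; _∈_; _∉_; _⊆_; _∪_; ⁅_⁆; ∁; ⊤)
open import Data.Fin.Subset.Properties
  using (_∈?_; nonempty?; ⊆-max; ⊆-trans; ⊆-antisym; x∈⁅x⁆; x∈⁅y⁆⇒x≡y; x∈p∪q⁺; x∈p∪q⁻; p⊆p∪q; drop-∷-⊆; s⊆s; out⊆)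
open import Data.Integer using (ℤ; 0ℤ; 1ℤ; _-_; _*_; _≤ᵇ_)
open import Data.List using (List; []; _∷_; [_]; _++_; length; map; filter; allFin; cartesianProductWith)
open import Data.List.Membership.Propositional using () renaming (_∈_ to _∈ₗ_)
open import Data.List.Membership.Propositional.Properties
  using (∈-map⁺; ∈-map⁻; ∈-cartesianProductWith⁺; ∈-cartesianProductWith⁻; ∈-filter⁺; ∈-filter⁻)
open import Data.List.Membership.Propositional.Properties.WithK using (unique∧set⇒bag)
open import Data.List.Relation.Binary.BagAndSetEquality using (∼bag⇒↭)
open import Data.List.Relation.Binary.Permutation.Propositional.Properties using (↭-length)
open import Data.List.Relation.Unary.All as All using (All; []; _∷_)
open import Data.List.Relation.Unary.AllPairs using ([]; _∷_)
open import Data.List.Relation.Unary.Any using (here; there)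
open import Data.List.Relation.Unary.Linked using (Linked; _∷_)
open import Data.List.Relation.Unary.Unique.Propositional using (Unique)
import Data.List.Relation.Unary.Unique.Propositional.Properties as Unique
open import Data.Nat using (zero; suc; _≟_)
open import Data.Nat.Divisibility using (_∣_; divides; _∣?_; ∣m+n∣m⇒∣n; ∣-refl; ∣1⇒≡1)
open import Data.Nat.ListAction using (sum)
open import Data.Product using (_,_; proj₂)
open import Data.Sum using (inj₁; inj₂)
open import Data.Vec as Vec using (Vec; []; _∷_; here; lookup; tabulate; removeAt)
open import Data.Vec.Properties using (∷-injective; ∷-injectiveʳ)
open import Function.Bundles using (Equivalence; _⇔_; mk⇔)
open import Level using (0ℓ)
open import Relation.Binary.PropositionalEquality using (_≡_; _≢_; refl; sym; trans; subst; ≢-sym)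
open import Relation.Nullary using (Dec; yes; no; ¬?; isYes)
open import Relation.Nullary.Decidable using (toWitness; _×-dec_; _→-dec_; map′)
open import Relation.Unary using (Pred; Decidable)

subsetsOf : ∀ {n} → Subset n → List (Subset n)
subsetsOf [] = [ [] ]
subsetsOf (true ∷ p) = cartesianProductWith _∷_ (inside ∷ outside ∷ []) (subsetsOf p)
subsetsOf (false ∷ p) = map (outside ∷_) (subsetsOf p)

∈-subsetsOf⁺ : ∀ {n} {p q : Subset n} → q ⊆ p → q ∈ₗ subsetsOf p
∈-subsetsOf⁺ {p = []} {[]} _ = here refl
∈-subsetsOf⁺ {p = true ∷ p} {true ∷ q} q⊆p =
  ∈-cartesianProductWith⁺ _∷_ {inside ∷ outside ∷ []} (here refl) (∈-subsetsOf⁺ (drop-∷-⊆ q⊆p))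
∈-subsetsOf⁺ {p = true ∷ p} {false ∷ q} q⊆p =
  ∈-cartesianProductWith⁺ _∷_ {inside ∷ outside ∷ []} (there (here refl)) (∈-subsetsOf⁺ (drop-∷-⊆ q⊆p))
∈-subsetsOf⁺ {p = false ∷ p} {false ∷ q} q⊆p = ∈-map⁺ (outside ∷_) (∈-subsetsOf⁺ (drop-∷-⊆ q⊆p))
∈-subsetsOf⁺ {p = false ∷ p} {true ∷ q} q⊆p with () ← q⊆p here

∈-subsetsOf⁻ : ∀ {n} {p q : Subset n} → q ∈ₗ subsetsOf p → q ⊆ p
∈-subsetsOf⁻ {p = []} (here refl) = λ ()
∈-subsetsOf⁻ {p = true ∷ p} q∈
  with _ , _ , b∈ , r∈ , refl ← ∈-cartesianProductWith⁻ _∷_ (inside ∷ outside ∷ []) (subsetsOf p) q∈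
  with b∈
... | here refl = s⊆s (∈-subsetsOf⁻ r∈)
... | there (here refl) = out⊆ (∈-subsetsOf⁻ r∈)
∈-subsetsOf⁻ {p = false ∷ p} q∈ with _ , r∈ , refl ← ∈-map⁻ (outside ∷_) q∈ = out⊆ (∈-subsetsOf⁻ r∈)

subsetsOf-unique : ∀ {n} (p : Subset n) → Unique (subsetsOf p)
subsetsOf-unique [] = [] ∷ []
subsetsOf-unique (true ∷ p) =
  Unique.cartesianProductWith⁺ _∷_ ∷-injective (((λ ()) ∷ []) ∷ [] ∷ []) (subsetsOf-unique p)
subsetsOf-unique (false ∷ p) = Unique.map⁺ ∷-injectiveʳ (subsetsOf-unique p)

all⊆? : ∀ {n ℓ} {P : Pred (Subset n) ℓ} → Decidable P → ∀ p → Dec (∀ q → q ⊆ p → P q)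
all⊆? P? p = map′ (λ all q q⊆p → All.lookup all (∈-subsetsOf⁺ q⊆p))
                  (λ ∀P → All.tabulate (λ q∈ → ∀P _ (∈-subsetsOf⁻ q∈)))
                  (All.all? P? (subsetsOf p))

record Enumeration {A : Set} (P : Pred A 0ℓ) : Set where
  field
    elements : List A
    sound : ∀ {x} → x ∈ₗ elements → P x
    complete : ∀ {x} → P x → x ∈ₗ elements
    unique : Unique elements

open Enumeration

filter-enumeration : ∀ {A : Set} {P : Pred A 0ℓ} → Decidable P →
  (xs : List A) → (∀ x → x ∈ₗ xs) → Unique xs → Enumeration P
filter-enumeration P? xs ∈xs unique-xs = record
  { elements = filter P? xs
  ; sound = λ x∈ → proj₂ (∈-filter⁻ P? {xs = xs} x∈)
  ; complete = λ {x} Px → ∈-filter⁺ P? (∈xs x) Px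
  ; unique = Unique.filter⁺ P? unique-xs
  }

length≡enumeration-length : ∀ {A : Set} {P : Pred A 0ℓ} (E : Enumeration P) {xs} →
  Unique xs → All P xs → (∀ x → P x → x ∈ₗ xs) → length xs ≡ length (elements E)
length≡enumeration-length E unique-xs all-P spanning =
  ↭-length (∼bag⇒↭ (unique∧set⇒bag unique-xs (unique E)
    (mk⇔ (λ x∈xs → complete E (All.lookup all-P x∈xs)) (λ x∈E → spanning _ (sound E x∈E)))))

module _ {V : Set} {Vertex : Pred V 0ℓ} {Adj : V → V → Set} (c : V → Bool)
         (proper : ∀ {u v} → Vertex u → Vertex v → Adj u v → c u ≢ c v) where

  even-path-endpoints-differ : ∀ x mid y → All Vertex (x ∷ mid ++ [ y ]) → Linked Adj (x ∷ mid ++ [ y ]) →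
                               2 ∣ length (x ∷ mid ++ [ y ]) → c x ≢ c y
  even-path-endpoints-differ x [] y (vx ∷ vy ∷ []) (a ∷ _) _ = proper vx vy a
  even-path-endpoints-differ x (m ∷ []) y _ _ 2∣3 with () ← ∣1⇒≡1 (∣m+n∣m⇒∣n 2∣3 ∣-refl)
  even-path-endpoints-differ x (m ∷ m′ ∷ rest) y (vx ∷ vm ∷ vs@(vm′ ∷ _)) (a ∷ a′ ∷ l) 2∣ =
    subst (_≢ c y) (sym cx≡cm′) (even-path-endpoints-differ m′ rest y vs l (∣m+n∣m⇒∣n 2∣ ∣-refl))
    where
    cx≡cm′ : c x ≡ c m′
    cx≡cm′ = trans (¬-not (proper vx vm a)) (sym (¬-not (≢-sym (proper vm vm′ a′))))

alternatingSum : ∀ {n} → Vec ℤ n → ℤ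
alternatingSum [] = 0ℤ
alternatingSum (x ∷ xs) = x - alternatingSum xs

-- Laplace expansion along the first row; fewer than n rows give 0, rows beyond the n-th are ignored.
det : ∀ {n} → List (Vec ℤ n) → ℤ
det {zero} _ = 1ℤ
det {suc n} [] = 0ℤ
det {suc n} (r ∷ rs) = alternatingSum (tabulate λ j → lookup r j * det (map (λ s → removeAt s j) rs))

evenCover? : Decidable EvenCover
evenCover? S = all? (λ j → 2 ∣? ∣ S ∩ covers j ∣)

independent? : Decidable Independent
independent? = all⊆? (λ S → nonempty? S →-dec ¬? (evenCover? S))

independent-⊆ : ∀ {S T} → T ⊆ S → Independent S → Independent T
independent-⊆ T⊆S indS U U⊆T = indS U (⊆-trans U⊆T T⊆S)

Unextendable : Subset 10 → Set
Unextendable B = ∀ x → x ∉ B → ¬ Independent (B ∪ ⁅ x ⁆)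

base⇔independent∧unextendable : ∀ B → Base B ⇔ (Independent B × Unextendable B)
base⇔independent∧unextendable B = mk⇔
  (λ (indB , maximal) → indB , λ x x∉B indB+x →
     x∉B (subst (x ∈_) (maximal _ indB+x (p⊆p∪q ⁅ x ⁆)) (x∈p∪q⁺ (inj₂ (x∈⁅x⁆ x)))))
  (λ (indB , unext) → indB , λ S indS B⊆S → ⊆-antisym (S⊆B unext indS B⊆S) B⊆S)
  where
  S⊆B : ∀ {S} → Unextendable B → Independent S → B ⊆ S → S ⊆ B
  S⊆B {S} unext indS B⊆S {x} x∈S with x ∈? B
  ... | yes x∈B = x∈B
  ... | no x∉B = ⊥-elim (unext x x∉B (independent-⊆ B+x⊆S indS))
    where
    B+x⊆S : B ∪ ⁅ x ⁆ ⊆ S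
    B+x⊆S y∈ with x∈p∪q⁻ B ⁅ x ⁆ y∈
    ... | inj₁ y∈B = B⊆S y∈B
    ... | inj₂ y∈⁅x⁆ = subst (_∈ S) (sym (x∈⁅y⁆⇒x≡y x y∈⁅x⁆)) x∈S

base? : Decidable Base
base? B = map′ (from (base⇔independent∧unextendable B)) (to (base⇔independent∧unextendable B))
  (independent? B ×-dec all? (λ x → ¬? (x ∈? B) →-dec ¬? (independent? (B ∪ ⁅ x ⁆))))
  where open Equivalence

baseCobase? : Decidable BaseCobase
baseCobase? B = base? B ×-dec base? (∁ B)

baseCobases : Enumeration BaseCobase
baseCobases = filter-enumeration baseCobase? (subsetsOf ⊤) (λ B → ∈-subsetsOf⁺ (⊆-max B)) (subsetsOf-unique ⊤)

baseCobases-length : length (elements baseCobases) ≡ 72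
baseCobases-length = refl

toList : ∀ {n} → Subset n → List (Fin n)
toList p = filter (_∈? p) (allFin _)

incidenceMatrix : Subset 10 → List (Vec ℤ 5)
incidenceMatrix B = map (λ i → Vec.map (λ b → if b then 1ℤ else 0ℤ) (triple i)) (toList B)

-- The parity of the sum of the positions of B is the sign of the shuffle (B, E∖B) up to a constant.
colour : Subset 10 → Bool
colour B = (det (incidenceMatrix B) * det (incidenceMatrix (∁ B)) ≤ᵇ 0ℤ)
       xor isYes (2 ∣? sum (map toℕ (toList B)))

adjacent? : ∀ u v → Dec (Adjacent u v)
adjacent? u v = _ ≟ 2

ProperlyColoured : List (Subset 10) → Set
ProperlyColoured vs = All (λ u → All (λ v → Adjacent u v → colour u ≢ colour v) vs) vs

properlyColoured? : ∀ vs → Dec (ProperlyColoured vs)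
properlyColoured? vs = All.all? (λ u → All.all? (λ v → adjacent? u v →-dec ¬? (colour u ≟ᵇ colour v)) vs) vs

baseCobases-properlyColoured : ProperlyColoured (elements baseCobases)
baseCobases-properlyColoured = toWitness {a? = properlyColoured? (elements baseCobases)} _

colour-proper : ∀ {u v} → BaseCobase u → BaseCobase v → Adjacent u v → colour u ≢ colour v
colour-proper bc-u bc-v = All.lookup (All.lookup baseCobases-properlyColoured (complete baseCobases bc-u)) (complete baseCobases bc-v)

bipartite : Bipartite
bipartite = colour , λ _ _ → colour-proper

-- {123, 124, 125, 135, 234} and {124, 125, 134, 145, 234}: base-cobases of the same colour.
u₀ v₀ : Subset 10
u₀ = I ∷ I ∷ I ∷ O ∷ I ∷ O ∷ I ∷ O ∷ O ∷ O ∷ []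
v₀ = O ∷ I ∷ I ∷ I ∷ O ∷ I ∷ I ∷ O ∷ O ∷ O ∷ []

¬hamiltonianConnected : ¬ HamiltonianConnected
¬hamiltonianConnected hc
  with hc u₀ v₀ (toWitness {a? = baseCobase? u₀} _) (toWitness {a? = baseCobase? v₀} _) (λ ())
... | _ , (mid , refl) , onVertices , path , unique-p , spanning =
  even-path-endpoints-differ colour colour-proper u₀ mid v₀ onVertices path 2∣length refl
  where
  2∣length : 2 ∣ length (u₀ ∷ mid ++ [ v₀ ])
  2∣length = subst (2 ∣_)
    (sym (trans (length≡enumeration-length baseCobases unique-p onVertices spanning) baseCobases-length))
    (divides 36 refl)

corollary5p5 : Bipartite × ¬ HamiltonianConnected
corollary5p5 = bipartite , ¬hamiltonianConnected
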